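{- Let $m,n\ge1$ and let $F$ be a face of the $m$-Shi arrangement in $\mathbb{R}^n$. Let $F_1,\dots,F_\ell$ be the faces of the $m$-Catalan arrangement in $\mathbb{R}^n$ whose disjoint union is $F$. Suppose that for some $i^*\in[\ell]$ the face $F_{i^*}$ equals $\Phi(T)$ for an $[n]$-decorated $(m+1)$-ary tree $T$ of Shi type. Then $\dim F_i\le\dim F_{i^*}$ for every $i\in[\ell]$, and consequently $\dim F=\dim F_{i^*}$.
   Context: $[n]=\{1,\dots,n\}$, $[a,b]=\{a,\dots,b\}$. A face of a finite hyperplane arrangement in $\mathbb{R}^n$ is a nonempty solution set of a system choosing for each hyperplane one of $<,=,>$; its dimension is that of its affine span. The $m$-Catalan arrangement: hyperplanes $x_i-x_j=s$ for distinct $i,j\in[n]$, $s\in[0,m]$. The $m$-Shi arrangement: hyperplanes $x_i-x_j=s$ for $1\le i<j\le n$, $s\in[-m+1,m]$; it is a subarrangement of the $m$-Catalan arrangement, so each $m$-Shi face is a disjoint union of $m$-Catalan faces. An $(m+1)$-ary tree is a rooted plane tree with every vertex having $m+1$ or $0$ children (leaves have none, nodes have $m+1$); the rank of a non-root vertex is the number of its preceding siblings. Internal edges join two nodes. If a node has a child of rank $>0$ that is a node, its cadet is the highest-rank such child, the edge to it a cadet edge. An $[n]$-decorated $(m+1)$-ary tree: node labels are nonempty subsets of $[n]$ forming a set partition, each cadet edge solid or dashed (others solid). Captive node: node joined to its parent by a dashed edge; free: not captive. Dead leaf: leaf with a captive sibling of smaller rank; live: not a dead leaf. Descent: internal edge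 with $\max A>\min B$ ($A$ parent's label, $B$ child's label); Shi type: every internal edge whose child has rank $m$ is a descent. $\rho(v)$: word in $\{E_0,\dots,E_m\}$ of edge ranks on the root-to-$v$ path; $\dot\rho(v)$: sum of these ranks. For distinct $v,w$: $v\prec_T w$ iff $\dot\rho(v)<\dot\rho(w)$, or equality and either $\rho(v)$ is a proper prefix of $\rho(w)$ or at the first differing position $\rho(v)$ has $E_b$, $\rho(w)$ has $E_a$ with $a<b$; $\preceq_T$ is $\prec_T$ or equality. $v_T(i)$: node whose label contains $i$; $v^s_T(i)$: its child of rank $s$; $\mathrm{nextlive}(v)$: $\prec_T$-least live $w$ with $v\preceq_T w$. Dashed path from $u$ to $w$: $w$ is a descendant of $u$ and all edges from $u$ down to $w$ are dashed. $\Phi(T)$ denotes the set of points $p\in\mathbb{R}^n$ such that: for all $i,j\in[n]$, $p_i\le p_j$ iff $v_T(i)\preceq_T v_T(j)$; for all $i,j\in[n]$, $s\in[1,m]$, $p_i<p_j+s$ iff $v_T(i)\prec_T v^s_T(j)$; and for all $i,j\in[n]$, $s\in[1,m]$, $p_i=p_j+s$ iff $v_T(i)=\mathrm{nextlive}(v^s_T(j))$ and there is a dashed path from $v_T(j)$ to $v_T(i)$.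
   Formalization: The space $\mathbb{R}^n$ is replaced by ℚ^n, so faces of the $m$-Shi and $m$-Catalan arrangements and $\Phi(T)$ consist of rational points, and dimensions are those of rational affine spans. -}

module Defs where

open import Data.Nat as ℕ using (ℕ; zero; suc)
open import Data.Integer as ℤ using (ℤ; +_)
open import Data.Rational as ℚ using (ℚ; _/_; 0ℚ)
open import Data.Fin as Fin using (Fin; toℕ)
open import Data.List using (List; []; _∷_; _++_; [_]; map)
open import Data.Nat.ListAction using (sum)
open import Data.Maybe using (Maybe; just; nothing)
open import Data.Bool using (Bool; true; false)
open import Data.Product using (Σ; ∃; ∃-syntax; _×_; _,_)
open import Data.Sum using (_⊎_)
open import Relation.Binary.PropositionalEquality using (_≡_; _≢_)
open import Relation.Nullary using (¬_)
open import Function.Bundles using (_⇔_)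

-- Points of ℚ^n (ℚ in place of ℝ)

Point : ℕ → Set
Point n = Fin n → ℚ

ℕ→ℚ : ℕ → ℚ
ℕ→ℚ k = (+ k) / 1

ℤ→ℚ : ℤ → ℚ
ℤ→ℚ k = k / 1

PSet : ℕ → Set₁
PSet n = Point n → Set

_⊆ₚ_ : ∀ {n} → PSet n → PSet n → Set
A ⊆ₚ B = ∀ q → A q → B q

_≐_ : ∀ {n} → PSet n → PSet n → Set
A ≐ B = ∀ q → A q ⇔ B q

-- Hyperplane x_i - x_j = c, and "p and q lie on the same side of it"
-- (same one of <, =, > ; over ℚ trichotomy makes two iff's suffice).

SameSide : ∀ {n} → Fin n → Fin n → ℚ → Point n → Point n → Set
SameSide i j c p q =
  ((p i ℚ.- p j) ℚ.< c ⇔ (q i ℚ.- q j) ℚ.< c) ×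
  ((p i ℚ.- p j) ≡ c ⇔ (q i ℚ.- q j) ≡ c)

CatSame : ∀ {n} (m : ℕ) → Point n → Point n → Set
CatSame {n} m p q =
  ∀ (i j : Fin n) → i ≢ j → ∀ (s : ℕ) → s ℕ.≤ m → SameSide i j (ℕ→ℚ s) p q

ShiSame : ∀ {n} (m : ℕ) → Point n → Point n → Set
ShiSame {n} m p q =
  ∀ (i j : Fin n) → i Fin.< j → ∀ (s : ℤ) →
    (+ 1) ℤ.- (+ m) ℤ.≤ s → s ℤ.≤ + m → SameSide i j (ℤ→ℚ s) p q

IsCatalanFace : ∀ {n} (m : ℕ) → PSet n → Set
IsCatalanFace m F = ∃[ p ] (∀ q → F q ⇔ CatSame m p q)

IsShiFace : ∀ {n} (m : ℕ) → PSet n → Set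
IsShiFace m F = ∃[ p ] (∀ q → F q ⇔ ShiSame m p q)

sumℚ : ∀ {k} → (Fin k → ℚ) → ℚ
sumℚ {zero} f = 0ℚ
sumℚ {suc k} f = f Fin.zero ℚ.+ sumℚ (λ t → f (Fin.suc t))

AffIndep : ∀ {n k} → (Fin k → Point n) → Set
AffIndep {n} {k} ps =
  ∀ (c : Fin k → ℚ) → sumℚ c ≡ 0ℚ →
    (∀ (x : Fin n) → sumℚ (λ t → c t ℚ.* ps t x) ≡ 0ℚ) →
    ∀ t → c t ≡ 0ℚ

HasDim : ∀ {n} → PSet n → ℕ → Set
HasDim {n} S d =
  (Σ (Fin (suc d) → Point n) λ ps → (∀ t → S (ps t)) × AffIndep ps) ×
  (∀ (ps : Fin (suc (suc d)) → Point n) → (∀ t → S (ps t)) → ¬ AffIndep ps)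

-- [n]-decorated (m+1)-ary trees.
-- node label (subset of [n] as a Bool-valued function), a flag telling
-- whether the cadet edge of this node is dashed, and m+1 children
-- indexed by rank 0..m.

data DTree (n m : ℕ) : Set where
  leaf : DTree n m
  node : (Fin n → Bool) → Bool → (Fin (suc m) → DTree n m) → DTree n m

-- vertices are addressed by the word ρ(v) of ranks from the root
Path : ℕ → Set
Path m = List (Fin (suc m))

module _ {n m : ℕ} where

  sub : DTree n m → Path m → Maybe (DTree n m)
  sub t [] = just t
  sub leaf (r ∷ p) = nothing
  sub (node l d c) (r ∷ p) = sub (c r) p

  IsVertex : DTree n m → Path m → Set
  IsVertex T v = ∃[ t ] (sub T v ≡ just t)

  IsLeaf : DTree n m → Path m → Set
  IsLeaf T v = sub T v ≡ just leaf

  IsNode : DTree n m → Path m → Set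
  IsNode T v = ∃[ l ] ∃[ d ] ∃[ c ] (sub T v ≡ just (node l d c))

  InLabel : DTree n m → Path m → Fin n → Set
  InLabel T v i = ∃[ l ] ∃[ d ] ∃[ c ] (sub T v ≡ just (node l d c) × l i ≡ true)

  DashFlag : DTree n m → Path m → Set
  DashFlag T v = ∃[ l ] ∃[ c ] (sub T v ≡ just (node l true c))

  IsCadet : DTree n m → Path m → Fin (suc m) → Set
  IsCadet T v r = IsNode T v × IsNode T (v ++ [ r ]) × 0 ℕ.< toℕ r ×
    (∀ (r' : Fin (suc m)) → r Fin.< r' → ¬ IsNode T (v ++ [ r' ]))

  HasCadet : DTree n m → Path m → Set
  HasCadet T v = ∃[ r ] IsCadet T v r

  DashedEdge : DTree n m → Path m → Fin (suc m) → Set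
  DashedEdge T v r = DashFlag T v × IsCadet T v r

  Decorated : DTree n m → Set
  Decorated T =
    (∀ v → IsNode T v → ∃[ i ] InLabel T v i) ×
    (∀ (i : Fin n) → ∃[ v ] InLabel T v i) ×
    (∀ (i : Fin n) v w → InLabel T v i → InLabel T w i → v ≡ w) ×
    (∀ v → DashFlag T v → HasCadet T v)

  Captive : DTree n m → Path m → Set
  Captive T w = ∃[ v ] ∃[ r ] (w ≡ v ++ [ r ] × DashedEdge T v r)

  DeadLeaf : DTree n m → Path m → Set
  DeadLeaf T w = IsLeaf T w × ∃[ v ] ∃[ r ] (w ≡ v ++ [ r ] ×
    ∃[ r' ] (r' Fin.< r × Captive T (v ++ [ r' ])))

  Live : DTree n m → Path m → Set
  Live T w = IsVertex T w × ¬ DeadLeaf T w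

  -- internal edge v → v++[r] is a descent: max A > min B,
  -- i.e. some a ∈ A, b ∈ B with a > b
  Descent : DTree n m → Path m → Fin (suc m) → Set
  Descent T v r = ∃[ a ] ∃[ b ] (InLabel T v a × InLabel T (v ++ [ r ]) b × b Fin.< a)

  ShiType : DTree n m → Set
  ShiType T = ∀ v → IsNode T v → IsNode T (v ++ [ Fin.fromℕ m ]) →
    Descent T v (Fin.fromℕ m)

  data DashedPath (T : DTree n m) : Path m → Path m → Set where
    done : ∀ {u} → DashedPath T u []
    step : ∀ {u r q} → DashedEdge T u r → DashedPath T (u ++ [ r ]) q →
           DashedPath T u (r ∷ q)

  DashedPathTo : DTree n m → Path m → Path m → Set
  DashedPathTo T u w = ∃[ q ] (w ≡ u ++ q × DashedPath T u q)

rankSum : ∀ {m} → Path m → ℕ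
rankSum p = sum (map toℕ p)

-- tie-breaking part of ≺_T : proper prefix, or at first difference
-- v has E_b and w has E_a with a < b
data TieLt {m : ℕ} : Path m → Path m → Set where
  pre   : ∀ {x xs} → TieLt [] (x ∷ xs)
  here  : ∀ {a b xs ys} → a Fin.< b → TieLt (b ∷ xs) (a ∷ ys)
  there : ∀ {x xs ys} → TieLt xs ys → TieLt (x ∷ xs) (x ∷ ys)

_≺_ : ∀ {m} → Path m → Path m → Set
v ≺ w = rankSum v ℕ.< rankSum w ⊎ (rankSum v ≡ rankSum w × TieLt v w)

_⪯_ : ∀ {m} → Path m → Path m → Set
v ⪯ w = v ≺ w ⊎ v ≡ w

module _ {n m : ℕ} where

  NextLive : DTree n m → Path m → Path m → Set
  NextLive T v w = Live T w × v ⪯ w ×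
    (∀ w' → Live T w' → v ⪯ w' → w ⪯ w')

  -- Φ(T); u = v_T(i), v = v_T(j), v ++ [s] = v^s_T(j)
  Φ : DTree n m → PSet n
  Φ T p = ∀ (i j : Fin n) (u v : Path m) → InLabel T u i → InLabel T v j →
    (p i ℚ.≤ p j ⇔ u ⪯ v) ×
    (∀ (s : Fin (suc m)) → 1 ℕ.≤ toℕ s →
       (p i ℚ.< p j ℚ.+ ℕ→ℚ (toℕ s) ⇔ u ≺ (v ++ [ s ])) ×
       (p i ≡ p j ℚ.+ ℕ→ℚ (toℕ s) ⇔
          (NextLive T (v ++ [ s ]) u × DashedPathTo T v u)))

{-# OPTIONS --safe #-}

-- Fix p ∈ F* = Φ(T). Every m-Catalan equation x_i - x_j = s (0 ≤ s ≤ m) satisfied by p holds on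
-- the whole Shi face F. This is immediate when s = 0 or when the equation is an m-Shi hyperplane.
-- For s ≥ 1 the description of Φ(T) yields a dashed path from v_T(j) to v_T(i); across a dashed
-- edge of rank r the coordinates of the two labels differ by exactly r at p, which is a Shi
-- equation when r < m and, when r = m, is replaced by one through the descent that the Shi type
-- puts on that edge. So z - p is constant along the path for every z ∈ F. Consequently, for z ∈ F
-- the point p + ε(z - p) lies in F* for all small ε > 0 (strict inequalities at p survive,
-- equalities at p hold at z), and this homothety centred at p maps affinely independent points of
-- F to affinely independent points of F*, whence dim F ≤ dim F*.

module Submission where

open import Defs
open import Data.Nat using (ℕ; _≤_)
open import Relation.Binary.PropositionalEquality using (_≡_)
open import Data.Product using (_×_; ∃-syntax)

open import Data.Nat as ℕ using (zero; suc; z≤n; s≤s; _≤′_; ≤′-refl; ≤′-step)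
import Data.Nat.Properties as ℕₚ
import Data.Integer as ℤ
import Data.Integer.Properties as ℤₚ
open import Data.Rational using (ℚ; 0ℚ; 1ℚ; _+_; _*_; _-_; -_; _<_; 1/_; positive; nonNegative)
import Data.Rational.Properties as ℚₚ
open import Data.Rational.Solver using (module +-*-Solver)
open import Data.Fin as Fin using (Fin; toℕ; fromℕ; fromℕ<)
import Data.Fin.Properties as Finₚ
import Data.Vec.Functional as Vector
open import Data.List using ([]; _∷_; _++_; [_])
open import Data.List.Properties using (++-identityʳ; ++-assoc)
open import Data.Maybe using (just)
open import Data.Product using (_,_; proj₁; proj₂)
open import Data.Sum as Sum using (_⊎_; inj₁; inj₂)
open import Data.Empty using (⊥-elim)
open import Function using (_∘_; id)
open import Function.Bundles using (_⇔_; mk⇔; Equivalence)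
open import Function.Construct.Identity using (⇔-id)
open import Function.Construct.Symmetry using (⇔-sym)
open import Function.Construct.Composition using (_⇔-∘_)
open import Relation.Nullary using (¬_; yes; no)
open import Relation.Binary.Definitions using (tri<; tri≈; tri>)
open import Relation.Binary.PropositionalEquality
  using (refl; sym; trans; cong; cong₂; subst; subst₂; module ≡-Reasoning)

open Equivalence using (to; from)
open +-*-Solver using (solve; con; _:+_; _:*_; _:-_; :-_; _:=_)

private
  variable
    n m k : ℕ

x-y≡k⇒x≡y+k : ∀ (x y : ℚ) {k} → x - y ≡ k → x ≡ y + k
x-y≡k⇒x≡y+k x y refl = solve 2 (λ x y → x := y :+ (x :- y)) refl x y

x≡y+k⇒x-y≡k : ∀ (x y : ℚ) {k} → x ≡ y + k → x - y ≡ k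
x≡y+k⇒x-y≡k _ y {k} refl = solve 2 (λ y k → (y :+ k) :- y := k) refl y k

y-x≡-[x-y] : ∀ (x y : ℚ) → y - x ≡ - (x - y)
y-x≡-[x-y] = solve 2 (λ x y → y :- x := :- (x :- y)) refl

x<y⇒0<y-x : ∀ {x y : ℚ} → x < y → 0ℚ < y - x
x<y⇒0<y-x {x} {y} x<y = subst (_< y - x) (ℚₚ.+-inverseʳ x) (ℚₚ.+-monoˡ-< (- x) x<y)

equalDiff⇒equalShift : ∀ (x y x' y' : ℚ) {k} → x - y ≡ k → x' - y' ≡ k → x' - x ≡ y' - y
equalDiff⇒equalShift x y x' y' refl eq = begin
  x' - x
    ≡⟨ solve 4 (λ x y x' y' → x' :- x := ((x' :- y') :- (x :- y)) :+ (y' :- y)) refl x y x' y' ⟩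
  ((x' - y') - (x - y)) + (y' - y)
    ≡⟨ cong (λ d → (d - (x - y)) + (y' - y)) eq ⟩
  ((x - y) - (x - y)) + (y' - y)
    ≡⟨ cong (_+ (y' - y)) (ℚₚ.+-inverseʳ (x - y)) ⟩
  0ℚ + (y' - y)
    ≡⟨ ℚₚ.+-identityˡ (y' - y) ⟩
  y' - y
    ∎
  where open ≡-Reasoning

equalShift⇒equalDiff : ∀ (x y x' y' : ℚ) {k} → x' - x ≡ y' - y → x - y ≡ k → x' - y' ≡ k
equalShift⇒equalDiff x y x' y' shift refl = begin
  x' - y'
    ≡⟨ solve 4 (λ x y x' y' → x' :- y' := (x :- y) :+ ((x' :- x) :- (y' :- y))) refl x y x' y' ⟩
  (x - y) + ((x' - x) - (y' - y))
    ≡⟨ cong (λ d → (x - y) + (d - (y' - y))) shift ⟩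
  (x - y) + ((y' - y) - (y' - y))
    ≡⟨ cong ((x - y) +_) (ℚₚ.+-inverseʳ (y' - y)) ⟩
  (x - y) + 0ℚ
    ≡⟨ ℚₚ.+-identityʳ (x - y) ⟩
  x - y
    ∎
  where open ≡-Reasoning

pos*x≡0⇒x≡0 : ∀ {ε x : ℚ} → 0ℚ < ε → ε * x ≡ 0ℚ → x ≡ 0ℚ
pos*x≡0⇒x≡0 {ε} {x} 0<ε εx≡0 = ℚₚ.≤-antisym
  (ℚₚ.*-cancelˡ-≤-pos ε (ℚₚ.≤-reflexive (trans εx≡0 (sym (ℚₚ.*-zeroʳ ε)))))
  (ℚₚ.*-cancelˡ-≤-pos ε (ℚₚ.≤-reflexive (trans (ℚₚ.*-zeroʳ ε) (sym εx≡0))))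
  where instance _ = positive 0<ε

SameSideOf : ℚ → ℚ → ℚ → Set
SameSideOf c x y = (x < c ⇔ y < c) × (x ≡ c ⇔ y ≡ c)

both-below : ∀ {c x y} → x < c → y < c → SameSideOf c x y
both-below x<c y<c = mk⇔ (λ _ → y<c) (λ _ → x<c) ,
                     mk⇔ (⊥-elim ∘ ℚₚ.<⇒≢ x<c) (⊥-elim ∘ ℚₚ.<⇒≢ y<c)

both-equal : ∀ {c x y} → x ≡ c → y ≡ c → SameSideOf c x y
both-equal x≡c y≡c = mk⇔ (λ x<c → ⊥-elim (ℚₚ.<⇒≢ x<c x≡c)) (λ y<c → ⊥-elim (ℚₚ.<⇒≢ y<c y≡c)) ,
                     mk⇔ (λ _ → y≡c) (λ _ → x≡c)

both-above : ∀ {c x y} → c < x → c < y → SameSideOf c x y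
both-above c<x c<y = mk⇔ (⊥-elim ∘ ℚₚ.<-asym c<x) (⊥-elim ∘ ℚₚ.<-asym c<y) ,
                     mk⇔ (⊥-elim ∘ ℚₚ.<⇒≢ c<x ∘ sym) (⊥-elim ∘ ℚₚ.<⇒≢ c<y ∘ sym)

ForSmallPositive : (ℚ → Set) → Set
ForSmallPositive Q = ∃[ ε₀ ] (0ℚ < ε₀ × (∀ ε → 0ℚ < ε → ε < ε₀ → Q ε))

ForSmallPositive-always : ∀ {Q} → (∀ ε → Q ε) → ForSmallPositive Q
ForSmallPositive-always q = 1ℚ , ℚₚ.positive⁻¹ 1ℚ , λ ε _ _ → q ε

ForSmallPositive-map : ∀ {Q R} → (∀ {ε} → Q ε → R ε) → ForSmallPositive Q → ForSmallPositive R
ForSmallPositive-map f (ε₀ , 0<ε₀ , q) = ε₀ , 0<ε₀ , λ ε 0<ε ε<ε₀ → f (q ε 0<ε ε<ε₀)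

ForSmallPositive-× : ∀ {Q R} → ForSmallPositive Q → ForSmallPositive R →
  ForSmallPositive (λ ε → Q ε × R ε)
ForSmallPositive-× (ε₁ , 0<ε₁ , q) (ε₂ , 0<ε₂ , r) with ℚₚ.≤-total ε₁ ε₂
... | inj₁ ε₁≤ε₂ = ε₁ , 0<ε₁ , λ ε 0<ε ε<ε₁ → q ε 0<ε ε<ε₁ , r ε 0<ε (ℚₚ.<-≤-trans ε<ε₁ ε₁≤ε₂)
... | inj₂ ε₂≤ε₁ = ε₂ , 0<ε₂ , λ ε 0<ε ε<ε₂ → q ε 0<ε (ℚₚ.<-≤-trans ε<ε₂ ε₂≤ε₁) , r ε 0<ε ε<ε₂

ForSmallPositive-witness : ∀ {Q} → ForSmallPositive Q → ∃[ ε ] (0ℚ < ε × Q ε)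
ForSmallPositive-witness (ε₀ , 0<ε₀ , q) with ℚₚ.<-dense 0<ε₀
... | ε , 0<ε , ε<ε₀ = ε , 0<ε , q ε 0<ε ε<ε₀

ForSmallPositive-Π : ∀ {Q : Fin k → ℚ → Set} →
  (∀ t → ForSmallPositive (Q t)) → ForSmallPositive (λ ε → ∀ t → Q t ε)
ForSmallPositive-Π {zero}  _ = ForSmallPositive-always (λ _ ())
ForSmallPositive-Π {suc k} q = ForSmallPositive-map (λ (q₀ , qₛ) → Finₚ.∀-cons q₀ qₛ)
  (ForSmallPositive-× (q Fin.zero) (ForSmallPositive-Π (q ∘ Fin.suc)))

ForSmallPositive-*< : ∀ (d : ℚ) {K} → 0ℚ < K → ForSmallPositive (λ ε → ε * d < K)
ForSmallPositive-*< d {K} 0<K with d ℚₚ.≤? 0ℚ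
... | yes d≤0 = 1ℚ , ℚₚ.positive⁻¹ 1ℚ , λ ε 0<ε _ → begin-strict
  ε * d   ≤⟨ ℚₚ.*-monoˡ-≤-nonNeg ε {{nonNegative (ℚₚ.<⇒≤ 0<ε)}} d≤0 ⟩
  ε * 0ℚ  ≡⟨ ℚₚ.*-zeroʳ ε ⟩
  0ℚ      <⟨ 0<K ⟩
  K       ∎
  where open ℚₚ.≤-Reasoning
... | no d≰0 = K * 1/ d , 0<K/d , λ ε _ ε<K/d → begin-strict
  ε * d           <⟨ ℚₚ.*-monoˡ-<-pos d ε<K/d ⟩
  K * 1/ d * d    ≡⟨ ℚₚ.*-assoc K (1/ d) d ⟩
  K * (1/ d * d)  ≡⟨ cong (K *_) (ℚₚ.*-inverseˡ d) ⟩
  K * 1ℚ          ≡⟨ ℚₚ.*-identityʳ K ⟩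
  K               ∎
  where
    open ℚₚ.≤-Reasoning
    instance
      _ = positive (ℚₚ.≰⇒> d≰0)
      _ = positive 0<K
      _ = ℚₚ.pos⇒nonZero d
    0<K/d : 0ℚ < K * 1/ d
    0<K/d = ℚₚ.positive⁻¹ _ {{ℚₚ.pos*pos⇒pos K (1/ d) {{ℚₚ.1/pos⇒pos d}}}}

segment-sameSide : ∀ {c x y} → (x ≡ c → y ≡ c) →
  ForSmallPositive (λ ε → SameSideOf c x (x + ε * (y - x)))
segment-sameSide {c} {x} {y} x≡c⇒y≡c with ℚₚ.<-cmp x c
... | tri≈ _ x≡c _ = ForSmallPositive-always λ ε → both-equal x≡c (begin
  x + ε * (y - x)  ≡⟨ cong₂ (λ a b → a + ε * (b - a)) x≡c (x≡c⇒y≡c x≡c) ⟩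
  c + ε * (c - c)  ≡⟨ solve 2 (λ c ε → c :+ ε :* (c :- c) := c) refl c ε ⟩
  c                ∎)
  where open ≡-Reasoning
... | tri< x<c _ _ = ForSmallPositive-map (λ {ε} εd<c-x → both-below x<c (begin-strict
  x + ε * (y - x)  <⟨ ℚₚ.+-monoʳ-< x εd<c-x ⟩
  x + (c - x)      ≡⟨ solve 2 (λ x c → x :+ (c :- x) := c) refl x c ⟩
  c                ∎))
  (ForSmallPositive-*< (y - x) (x<y⇒0<y-x x<c))
  where open ℚₚ.≤-Reasoning
... | tri> _ _ c<x = ForSmallPositive-map (λ {ε} εd<x-c → both-above c<x (begin-strict
  c                    ≡⟨ solve 2 (λ x c → c := x :- (x :- c)) refl x c ⟩
  x - (x - c)          <⟨ ℚₚ.+-monoʳ-< x (ℚₚ.neg-antimono-< εd<x-c) ⟩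
  x - ε * (x - y)      ≡⟨ solve 3 (λ x y ε → x :- ε :* (x :- y) := x :+ ε :* (y :- x)) refl x y ε ⟩
  x + ε * (y - x)      ∎))
  (ForSmallPositive-*< (x - y) (x<y⇒0<y-x c<x))
  where open ℚₚ.≤-Reasoning

CatSame-refl : ∀ m (p : Point n) → CatSame m p p
CatSame-refl m p _ _ _ _ _ = ⇔-id _ , ⇔-id _

segment : Point n → Point n → ℚ → Point n
segment p q ε x = p x + ε * (q x - p x)

OnCatalanHyperplanesOf : ℕ → Point n → Point n → Set
OnCatalanHyperplanesOf m p q = ∀ i j s → s ≤ m → p i - p j ≡ ℕ→ℚ s → q i - q j ≡ ℕ→ℚ s

segment-diff : ∀ (p q : Point n) ε i j →
  segment p q ε i - segment p q ε j ≡ (p i - p j) + ε * ((q i - q j) - (p i - p j))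
segment-diff p q ε i j = solve 5
  (λ ε pᵢ pⱼ qᵢ qⱼ → (pᵢ :+ ε :* (qᵢ :- pᵢ)) :- (pⱼ :+ ε :* (qⱼ :- pⱼ))
                  := (pᵢ :- pⱼ) :+ ε :* ((qᵢ :- qⱼ) :- (pᵢ :- pⱼ)))
  refl ε (p i) (p j) (q i) (q j)

CatSame-segment : ∀ {p q : Point n} → OnCatalanHyperplanesOf m p q →
  ForSmallPositive (λ ε → CatSame m p (segment p q ε))
CatSame-segment {m = m} {p} {q} p⊑q = ForSmallPositive-map (λ {ε} → restrict {ε})
  (ForSmallPositive-Π λ i → ForSmallPositive-Π λ j → ForSmallPositive-Π λ (s : Fin (suc m)) →
     segment-sameSide (p⊑q i j (toℕ s) (ℕₚ.≤-pred (Finₚ.toℕ<n s))))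
  where
    restrict : ∀ {ε} →
      (∀ i j (s : Fin (suc m)) → SameSideOf (ℕ→ℚ (toℕ s)) (p i - p j)
                                   ((p i - p j) + ε * ((q i - q j) - (p i - p j)))) →
      CatSame m p (segment p q ε)
    restrict {ε} sameSide i j _ s s≤m =
      subst₂ (λ k → SameSideOf (ℕ→ℚ k) (p i - p j))
        (Finₚ.toℕ-fromℕ< (s≤s s≤m)) (sym (segment-diff p q ε i j))
        (sameSide i j (fromℕ< (s≤s s≤m)))

sumℚ-segment : ∀ (c : Fin k → ℚ) (a ε : ℚ) (b : Fin k → ℚ) →
  sumℚ (λ t → c t * (a + ε * (b t - a)))
    ≡ sumℚ c * a + ε * (sumℚ (λ t → c t * b t) - sumℚ c * a)
sumℚ-segment {zero} c a ε b =
  solve 2 (λ a ε → con 0ℚ := con 0ℚ :* a :+ ε :* (con 0ℚ :- con 0ℚ :* a)) refl a ε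
sumℚ-segment {suc k} c a ε b = begin
  c₀ * (a + ε * (b₀ - a)) + sumℚ (λ t → cₛ t * (a + ε * (bₛ t - a)))
    ≡⟨ cong (c₀ * (a + ε * (b₀ - a)) +_) (sumℚ-segment cₛ a ε bₛ) ⟩
  c₀ * (a + ε * (b₀ - a)) + (C * a + ε * (B - C * a))
    ≡⟨ solve 6 (λ c₀ b₀ a ε C B →
         c₀ :* (a :+ ε :* (b₀ :- a)) :+ (C :* a :+ ε :* (B :- C :* a))
           := (c₀ :+ C) :* a :+ ε :* ((c₀ :* b₀ :+ B) :- (c₀ :+ C) :* a)) refl c₀ b₀ a ε C B ⟩
  (c₀ + C) * a + ε * ((c₀ * b₀ + B) - (c₀ + C) * a)
    ∎
  where
    open ≡-Reasoning
    c₀ = c Fin.zero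
    b₀ = b Fin.zero
    cₛ = c ∘ Fin.suc
    bₛ = b ∘ Fin.suc
    C = sumℚ cₛ
    B = sumℚ (λ t → cₛ t * bₛ t)

AffIndep-segment : ∀ {p : Point n} {qs : Fin k → Point n} {ε} → 0ℚ < ε →
  AffIndep qs → AffIndep (λ t → segment p (qs t) ε)
AffIndep-segment {p = p} {qs} {ε} 0<ε indep c Σc≡0 Σc·segment≡0 =
  indep c Σc≡0 λ x → pos*x≡0⇒x≡0 0<ε (begin
    ε * Σc·q x
      ≡⟨ solve 3 (λ ε B a → ε :* B := con 0ℚ :* a :+ ε :* (B :- con 0ℚ :* a))
               refl ε (Σc·q x) (p x) ⟩
    0ℚ * p x + ε * (Σc·q x - 0ℚ * p x)
      ≡⟨ cong (λ C → C * p x + ε * (Σc·q x - C * p x)) (sym Σc≡0) ⟩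
    sumℚ c * p x + ε * (Σc·q x - sumℚ c * p x)
      ≡⟨ sumℚ-segment c (p x) ε (λ t → qs t x) ⟨
    sumℚ (λ t → c t * segment p (qs t) ε x)
      ≡⟨ Σc·segment≡0 x ⟩
    0ℚ ∎)
  where
    open ≡-Reasoning
    Σc·q : Fin _ → ℚ
    Σc·q x = sumℚ (λ t → c t * qs t x)

record IndepIn (S : PSet n) (k : ℕ) : Set where
  constructor indepIn
  field
    points      : Fin k → Point n
    points∈S    : ∀ t → S (points t)
    independent : AffIndep points

IndepIn-tail : ∀ {S : PSet n} → IndepIn S (suc k) → IndepIn S k
IndepIn-tail (indepIn ps ps∈S indep) = indepIn (ps ∘ Fin.suc) (ps∈S ∘ Fin.suc) λ c Σc≡0 Σc·p≡0 t →
  indep (0ℚ Vector.∷ c) (trans (ℚₚ.+-identityˡ _) Σc≡0)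
    (λ x → trans (cong (_+ sumℚ (λ t → c t * ps (Fin.suc t) x)) (ℚₚ.*-zeroˡ (ps Fin.zero x)))
                 (trans (ℚₚ.+-identityˡ _) (Σc·p≡0 x)))
    (Fin.suc t)

IndepIn-≤′ : ∀ {S : PSet n} {k k'} → k ≤′ k' → IndepIn S k' → IndepIn S k
IndepIn-≤′ ≤′-refl = id
IndepIn-≤′ (≤′-step k≤′k') = IndepIn-≤′ k≤′k' ∘ IndepIn-tail

IndepIn-⊆ : ∀ {S S' : PSet n} → S ⊆ₚ S' → IndepIn S k → IndepIn S' k
IndepIn-⊆ S⊆S' (indepIn ps ps∈S indep) = indepIn ps (λ t → S⊆S' (ps t) (ps∈S t)) indep

HasDim-indepIn : ∀ {S : PSet n} {d} → HasDim S d → IndepIn S (suc d)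
HasDim-indepIn ((ps , ps∈S , indep) , _) = indepIn ps ps∈S indep

HasDim-bound : ∀ {S : PSet n} {d} → HasDim S d → IndepIn S k → k ≤ suc d
HasDim-bound {k = k} {d = d} (_ , noMore) I with k ℕₚ.≤? suc d
... | yes k≤1+d = k≤1+d
... | no k≰1+d with IndepIn-≤′ (ℕₚ.≤⇒≤′ (ℕₚ.≰⇒> k≰1+d)) I
...   | indepIn ps ps∈S indep = ⊥-elim (noMore ps ps∈S indep)

HasDim-mono : ∀ {S S' : PSet n} {d d'} → S ⊆ₚ S' → HasDim S d → HasDim S' d' → d ≤ d'
HasDim-mono S⊆S' S-dim S'-dim =
  ℕₚ.≤-pred (HasDim-bound S'-dim (IndepIn-⊆ S⊆S' (HasDim-indepIn S-dim)))

IndepIn-segment : ∀ {S S' : PSet n} {p} →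
  (∀ q → S q → ForSmallPositive (λ ε → S' (segment p q ε))) → IndepIn S k → IndepIn S' k
IndepIn-segment {p = p} near (indepIn qs qs∈S indep)
  with ForSmallPositive-witness (ForSmallPositive-Π (λ t → near (qs t) (qs∈S t)))
... | ε , 0<ε , segment∈S' =
  indepIn (λ t → segment p (qs t) ε) segment∈S' (AffIndep-segment {p = p} 0<ε indep)

ShiSame-sym : ∀ (p q : Point n) → ShiSame m p q → ShiSame m q p
ShiSame-sym _ _ p~q i j i<j s lo hi with p~q i j i<j s lo hi
... | below , on = ⇔-sym below , ⇔-sym on

ShiSame-trans : ∀ (p q r : Point n) → ShiSame m p q → ShiSame m q r → ShiSame m p r
ShiSame-trans _ _ _ p~q q~r i j i<j s lo hi with p~q i j i<j s lo hi | q~r i j i<j s lo hi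
... | below , on | below' , on' = below' ⇔-∘ below , on' ⇔-∘ on

1-m≤-s : ∀ {m s} → s ℕ.< m → ℤ.+ 1 ℤ.- ℤ.+ m ℤ.≤ ℤ.- ℤ.+ s
1-m≤-s {m} {s} s<m = begin
  ℤ.+ 1 ℤ.- ℤ.+ m  ≡⟨ ℤₚ.[+m]-[+n]≡m⊖n 1 m ⟩
  1 ℤ.⊖ m          ≤⟨ ℤₚ.⊖-monoʳ-≥-≤ 1 s<m ⟩
  1 ℤ.⊖ suc s      ≡⟨ ℤₚ.[1+m]⊖[1+n]≡m⊖n 0 s ⟩
  0 ℤ.⊖ s          ≡⟨ ℤₚ.⊖-≤ z≤n ⟩
  ℤ.- ℤ.+ s        ∎
  where open ℤₚ.≤-Reasoning

ℤ→ℚ-neg : ∀ s → ℤ→ℚ (ℤ.- ℤ.+ s) ≡ - ℕ→ℚ s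
ℤ→ℚ-neg zero    = refl
ℤ→ℚ-neg (suc s) = refl

-- Under either side condition x_i - x_j = s is an m-Shi hyperplane up to orientation (or i = j).
ShiSame-diff : ∀ {p q : Point n} → 1 ≤ m → ShiSame m p q → ∀ i j {s} → s ≤ m → s ℕ.< m ⊎ i Fin.< j →
  p i - p j ≡ ℕ→ℚ s → q i - q j ≡ ℕ→ℚ s
ShiSame-diff {p = p} {q} m≥1 p~q i j {s} s≤m s<m⊎i<j pᵢ-pⱼ≡s with Finₚ.<-cmp i j
... | tri< i<j _ _ =
  to (proj₂ (p~q i j i<j (ℤ.+ s) (ℤₚ.≤-trans (1-m≤-s m≥1) (ℤ.+≤+ z≤n)) (ℤ.+≤+ s≤m))) pᵢ-pⱼ≡s
... | tri≈ _ refl _ = trans (ℚₚ.+-inverseʳ (q i)) (trans (sym (ℚₚ.+-inverseʳ (p i))) pᵢ-pⱼ≡s)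
... | tri> _ _ j<i with s<m⊎i<j
...   | inj₂ i<j = ⊥-elim (Finₚ.<-asym i<j j<i)
...   | inj₁ s<m = ℚₚ.neg-injective (trans (sym (y-x≡-[x-y] (q i) (q j))) qⱼ-qᵢ≡-s)
  where
    pⱼ-pᵢ≡-s : p j - p i ≡ ℤ→ℚ (ℤ.- ℤ.+ s)
    pⱼ-pᵢ≡-s = trans (y-x≡-[x-y] (p i) (p j)) (trans (cong -_ pᵢ-pⱼ≡s) (sym (ℤ→ℚ-neg s)))
    qⱼ-qᵢ≡-s : q j - q i ≡ - ℕ→ℚ s
    qⱼ-qᵢ≡-s = trans (to (proj₂ (p~q j i j<i (ℤ.- ℤ.+ s) (1-m≤-s s<m) ℤₚ.neg-≤-pos)) pⱼ-pᵢ≡-s)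
                     (ℤ→ℚ-neg s)

toℕ<⊎≡fromℕ : ∀ (r : Fin (suc m)) → toℕ r ℕ.< m ⊎ r ≡ fromℕ m
toℕ<⊎≡fromℕ {zero}  Fin.zero    = inj₂ refl
toℕ<⊎≡fromℕ {suc m} Fin.zero    = inj₁ (s≤s z≤n)
toℕ<⊎≡fromℕ {suc m} (Fin.suc r) = Sum.map s≤s (cong Fin.suc) (toℕ<⊎≡fromℕ r)

module _ {T : DTree n m} where

  IsNode⇒Live : ∀ {v} → IsNode T v → Live T v
  IsNode⇒Live (l , d , c , v-node) =
    (node l d c , v-node) , λ (v-leaf , _) → leaf≢node (trans (sym v-leaf) v-node)
    where
      leaf≢node : ¬ (just leaf ≡ just (node l d c))
      leaf≢node ()

  NextLive-self : ∀ {v} → IsNode T v → NextLive T v v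
  NextLive-self v-node = IsNode⇒Live v-node , inj₂ refl , λ _ _ v⪯w → v⪯w

module _ {T : DTree n m} {P : Point n} (P∈ΦT : Φ T P) where

  Φ-sameLabel : ∀ w x y → InLabel T w x → InLabel T w y → P x ≡ P y
  Φ-sameLabel w x y x∈w y∈w = ℚₚ.≤-antisym (from (proj₁ (P∈ΦT x y w w x∈w y∈w)) (inj₂ refl))
                                            (from (proj₁ (P∈ΦT y x w w y∈w x∈w)) (inj₂ refl))

  Φ-dashedEdge : ∀ w r a c → DashedEdge T w r → InLabel T w a → InLabel T (w ++ [ r ]) c →
    P c - P a ≡ ℕ→ℚ (toℕ r)
  Φ-dashedEdge w r a c dashed@(_ , _ , child-node , 0<r , _) a∈w c∈child =
    x≡y+k⇒x-y≡k (P c) (P a) (from (proj₂ (proj₂ (P∈ΦT c a (w ++ [ r ]) w c∈child a∈w) r 0<r))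
      (NextLive-self child-node , [ r ] , refl , step dashed done))

  Φ-dashedPath : ∀ i j u v {s} → 1 ≤ s → s ≤ m → InLabel T u i → InLabel T v j →
    P i - P j ≡ ℕ→ℚ s → DashedPathTo T v u
  Φ-dashedPath i j u v {s} 1≤s s≤m i∈u j∈v Pᵢ-Pⱼ≡s =
    proj₂ (to (proj₂ (proj₂ (P∈ΦT i j u v i∈u j∈v) t (subst (1 ≤_) (sym toℕt≡s) 1≤s)))
              (x-y≡k⇒x≡y+k (P i) (P j) (subst (λ k → P i - P j ≡ ℕ→ℚ k) (sym toℕt≡s) Pᵢ-Pⱼ≡s)))
    where
      t : Fin (suc m)
      t = fromℕ< (s≤s s≤m)
      toℕt≡s : toℕ t ≡ s
      toℕt≡s = Finₚ.toℕ-fromℕ< (s≤s s≤m)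

module ShiInvariance {n m} (m≥1 : 1 ≤ m) {T : DTree n m} (dec : Decorated T) (shi : ShiType T)
  (P : Point n) (P∈ΦT : Φ T P) (z : Point n) (P~z : ShiSame m P z) where

  δ : Fin n → ℚ
  δ x = z x - P x

  δ-shi : ∀ i j {s} → s ≤ m → s ℕ.< m ⊎ i Fin.< j → P i - P j ≡ ℕ→ℚ s → δ i ≡ δ j
  δ-shi i j s≤m shiHyperplane Pᵢ-Pⱼ≡s = equalDiff⇒equalShift (P i) (P j) (z i) (z j) Pᵢ-Pⱼ≡s
    (ShiSame-diff {p = P} {q = z} m≥1 P~z i j s≤m shiHyperplane Pᵢ-Pⱼ≡s)

  δ-sameLabel : ∀ w x y → InLabel T w x → InLabel T w y → δ x ≡ δ y
  δ-sameLabel w x y x∈w y∈w = δ-shi x y z≤n (inj₁ m≥1)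
    (trans (cong (_- P y) (Φ-sameLabel P∈ΦT w x y x∈w y∈w)) (ℚₚ.+-inverseʳ (P y)))

  δ-dashedEdge : ∀ w r a c → DashedEdge T w r → InLabel T w a → InLabel T (w ++ [ r ]) c →
    δ a ≡ δ c
  δ-dashedEdge w r a c dashed@(_ , w-node , child-node , _) a∈w c∈child with toℕ<⊎≡fromℕ r
  ... | inj₁ r<m =
    sym (δ-shi c a (ℕₚ.<⇒≤ r<m) (inj₁ r<m) (Φ-dashedEdge P∈ΦT w r a c dashed a∈w c∈child))
  ... | inj₂ refl with shi w w-node child-node
  ...   | a' , b' , a'∈w , b'∈child , b'<a' = begin
    δ a   ≡⟨ δ-sameLabel w a a' a∈w a'∈w ⟩
    δ a'  ≡⟨ sym (δ-shi b' a' ℕₚ.≤-refl (inj₂ b'<a') Pb'-Pa'≡m) ⟩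
    δ b'  ≡⟨ δ-sameLabel child b' c b'∈child c∈child ⟩
    δ c   ∎
    where
      open ≡-Reasoning
      child = w ++ [ fromℕ m ]
      Pb'-Pa'≡m : P b' - P a' ≡ ℕ→ℚ m
      Pb'-Pa'≡m = begin
        P b' - P a'          ≡⟨ cong₂ _-_ (Φ-sameLabel P∈ΦT child b' c b'∈child c∈child)
                                          (Φ-sameLabel P∈ΦT w a' a a'∈w a∈w) ⟩
        P c - P a            ≡⟨ Φ-dashedEdge P∈ΦT w (fromℕ m) a c dashed a∈w c∈child ⟩
        ℕ→ℚ (toℕ (fromℕ m))  ≡⟨ cong ℕ→ℚ (Finₚ.toℕ-fromℕ m) ⟩
        ℕ→ℚ m                ∎

  δ-dashedPath : ∀ u q a b → DashedPath T u q → InLabel T u a → InLabel T (u ++ q) b → δ a ≡ δ b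
  δ-dashedPath u [] a b done a∈u b∈u =
    δ-sameLabel u a b a∈u (subst (λ v → InLabel T v b) (++-identityʳ u) b∈u)
  δ-dashedPath u (r ∷ q) a b (step dashed@(_ , _ , child-node , _) rest) a∈u b∈end
    with proj₁ dec (u ++ [ r ]) child-node
  ... | c , c∈child = trans (δ-dashedEdge u r a c dashed a∈u c∈child)
    (δ-dashedPath (u ++ [ r ]) q c b rest c∈child
      (subst (λ v → InLabel T v b) (sym (++-assoc u [ r ] q)) b∈end))

  catalanHyperplanes-preserved : OnCatalanHyperplanesOf m P z
  catalanHyperplanes-preserved i j zero _ Pᵢ-Pⱼ≡0 =
    ShiSame-diff {p = P} {q = z} m≥1 P~z i j z≤n (inj₁ m≥1) Pᵢ-Pⱼ≡0
  catalanHyperplanes-preserved i j (suc s) 1+s≤m Pᵢ-Pⱼ≡1+s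
    with proj₁ (proj₂ dec) i | proj₁ (proj₂ dec) j
  ... | u , i∈u | v , j∈v with Φ-dashedPath P∈ΦT i j u v (s≤s z≤n) 1+s≤m i∈u j∈v Pᵢ-Pⱼ≡1+s
  ...   | q , refl , path = equalShift⇒equalDiff (P i) (P j) (z i) (z j)
    (sym (δ-dashedPath v q j i path j∈v i∈u)) Pᵢ-Pⱼ≡1+s

proposition4p2 : (m n : ℕ) → 1 ≤ m → 1 ≤ n →
    (F : PSet n) → IsShiFace m F →
    (Fstar : PSet n) → IsCatalanFace m Fstar → Fstar ⊆ₚ F →
    (T : DTree n m) → Decorated T → ShiType T → Fstar ≐ Φ T →
    (∀ (G : PSet n) → IsCatalanFace m G → G ⊆ₚ F →
       ∀ d e → HasDim G d → HasDim Fstar e → d ≤ e) ×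
    (∀ d e → HasDim F d → HasDim Fstar e → d ≡ e)
proposition4p2 m n m≥1 _ F (f , F≐) F* (p , F*≐) F*⊆F T dec shi F*≐Φ =
  (λ G _ G⊆F _ _ → dim≤dimF* G⊆F) ,
  (λ _ _ F-dim F*-dim →
     ℕₚ.≤-antisym (dim≤dimF* (λ _ → id) F-dim F*-dim) (HasDim-mono F*⊆F F*-dim F-dim))
  where
    p∈F* : F* p
    p∈F* = from (F*≐ p) (CatSame-refl m p)

    F-near-p : ∀ q → F q → ForSmallPositive (λ ε → F* (segment p q ε))
    F-near-p q q∈F = ForSmallPositive-map (from (F*≐ _)) (CatSame-segment {p = p} {q}
      (ShiInvariance.catalanHyperplanes-preserved m≥1 dec shi p (to (F*≐Φ p) p∈F*) q p~q))
      where
        p~q : ShiSame m p q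
        p~q = ShiSame-trans p f q (ShiSame-sym f p (to (F≐ p) (F*⊆F p p∈F*))) (to (F≐ q) q∈F)

    dim≤dimF* : ∀ {S d e} → S ⊆ₚ F → HasDim S d → HasDim F* e → d ≤ e
    dim≤dimF* S⊆F S-dim F*-dim = ℕₚ.≤-pred (HasDim-bound F*-dim
      (IndepIn-segment {S' = F*} {p} (λ q → F-near-p q ∘ S⊆F q) (HasDim-indepIn S-dim)))
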